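{- Let $n$ be a positive integer and let $MS(n)$ be the number of multi-symmetric Steinhaus matrices of size $n$. Then $MS(n)=2^{\left\lceil \frac{n}{6}\right\rceil}$ if $n$ is even, and $MS(n)=2^{\left\lceil \frac{n-3}{6}\right\rceil}$ if $n$ is odd.
   Context: A Steinhaus matrix of size $n\geq1$ is a matrix $M=(a_{i,j})_{1\leq i,j\leq n}$ with entries in $\mathbb{F}_2=\{0,1\}$ such that $a_{i,i}=0$ for all $i$, $a_{i,j}=a_{i-1,j-1}+a_{i-1,j}$ (addition in $\mathbb{F}_2$) for all $2\leq i<j\leq n$, and $a_{i,j}=a_{j,i}$ for all $i,j$. A square matrix $(a_{i,j})$ of size $n$ is doubly-symmetric if $a_{i,j}=a_{j,i}=a_{n-j+1,n-i+1}$ for all $i,j$; it is multi-symmetric if it is doubly-symmetric and $a_{i,j}=a_{i,n-j+i+1}$ for all $1\leq i<j\leq n$. -}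

module Defs where

open import Data.Bool using (Bool; true; false; _xor_)
open import Data.Bool.Properties using () renaming (_≟_ to _≟ᵇ_)
open import Data.Nat using (ℕ; zero; suc; _∸_; _+_; _<_; _≤_; _<?_; _≤?_)
open import Data.Fin using (Fin; toℕ)
open import Data.Fin.Properties using (all?)
open import Data.Vec using (Vec; []; _∷_)
open import Data.List using (List; []; _∷_; map; concatMap; filter; length)
open import Data.Product using (_×_)
open import Relation.Binary.PropositionalEquality using (_≡_)
open import Relation.Nullary using (Dec)
open import Relation.Nullary.Decidable using (_×-dec_; _→-dec_)

-- An n×n matrix over F₂ = Bool (false = 0, true = 1, xor = addition),
-- stored as a vector of n rows.
Matrix : ℕ → Set
Matrix n = Vec (Vec Bool n) n

-- Entry at 0-based row i, column j (ℕ indices); only ever used in range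
-- (the default 'false' outside the range is never consulted below).
entry : ∀ {m k} → Vec (Vec Bool k) m → ℕ → ℕ → Bool
entry []         i       j       = false
entry (r ∷ rs)   (suc i) j       = entry rs i j
entry (r ∷ rs)   zero    j       = col r j
  where
  col : ∀ {k} → Vec Bool k → ℕ → Bool
  col []       _       = false
  col (b ∷ bs) zero    = b
  col (b ∷ bs) (suc j) = col bs j

-- All conditions below are the paper's, translated to 0-based indices
-- i , j ∈ {0,…,n-1} (paper index = our index + 1).

-- Steinhaus matrix:
--   a_{i,i} = 0;
--   a_{i,j} = a_{i-1,j-1} + a_{i-1,j}  for 2 ≤ i < j ≤ n  (1-based);
--   a_{i,j} = a_{j,i}.
IsSteinhaus : ∀ n → Matrix n → Set
IsSteinhaus n M =
  (∀ (i : Fin n) → entry M (toℕ i) (toℕ i) ≡ false) ×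
  (∀ (i j : Fin n) → 1 ≤ toℕ i → toℕ i < toℕ j →
     entry M (toℕ i) (toℕ j) ≡ (entry M (toℕ i ∸ 1) (toℕ j ∸ 1) xor entry M (toℕ i ∸ 1) (toℕ j))) ×
  (∀ (i j : Fin n) → entry M (toℕ i) (toℕ j) ≡ entry M (toℕ j) (toℕ i))

-- Doubly-symmetric: a_{i,j} = a_{j,i} = a_{n-j+1,n-i+1} (1-based),
-- i.e. with 0-based indices a_{i,j} = a_{j,i} = a_{n-1-j,n-1-i}.
IsDoublySymmetric : ∀ n → Matrix n → Set
IsDoublySymmetric n M =
  ∀ (i j : Fin n) →
    (entry M (toℕ i) (toℕ j) ≡ entry M (toℕ j) (toℕ i)) ×
    (entry M (toℕ j) (toℕ i) ≡ entry M (n ∸ 1 ∸ toℕ j) (n ∸ 1 ∸ toℕ i))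

-- Multi-symmetric: doubly-symmetric and a_{i,j} = a_{i,n-j+i+1} for
-- 1 ≤ i < j ≤ n (1-based); 0-based: a_{i,j} = a_{i,n-j+i} for i < j.
IsMultiSymmetric : ∀ n → Matrix n → Set
IsMultiSymmetric n M =
  IsDoublySymmetric n M ×
  (∀ (i j : Fin n) → toℕ i < toℕ j →
     entry M (toℕ i) (toℕ j) ≡ entry M (toℕ i) (n ∸ toℕ j + toℕ i))

IsMultiSymmetricSteinhaus : ∀ n → Matrix n → Set
IsMultiSymmetricSteinhaus n M = IsSteinhaus n M × IsMultiSymmetric n M

isSteinhaus? : ∀ n (M : Matrix n) → Dec (IsSteinhaus n M)
isSteinhaus? n M =
  all? (λ i → entry M (toℕ i) (toℕ i) ≟ᵇ false) ×-dec
  all? (λ i → all? (λ j → (1 ≤? toℕ i) →-dec ((toℕ i <? toℕ j) →-dec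
     (entry M (toℕ i) (toℕ j) ≟ᵇ (entry M (toℕ i ∸ 1) (toℕ j ∸ 1) xor entry M (toℕ i ∸ 1) (toℕ j)))))) ×-dec
  all? (λ i → all? (λ j → entry M (toℕ i) (toℕ j) ≟ᵇ entry M (toℕ j) (toℕ i)))

isMultiSymmetric? : ∀ n (M : Matrix n) → Dec (IsMultiSymmetric n M)
isMultiSymmetric? n M =
  all? (λ i → all? (λ j →
    (entry M (toℕ i) (toℕ j) ≟ᵇ entry M (toℕ j) (toℕ i)) ×-dec
    (entry M (toℕ j) (toℕ i) ≟ᵇ entry M (n ∸ 1 ∸ toℕ j) (n ∸ 1 ∸ toℕ i)))) ×-dec
  all? (λ i → all? (λ j → (toℕ i <? toℕ j) →-dec
    (entry M (toℕ i) (toℕ j) ≟ᵇ entry M (toℕ i) (n ∸ toℕ j + toℕ i))))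

isMSS? : ∀ n (M : Matrix n) → Dec (IsMultiSymmetricSteinhaus n M)
isMSS? n M = isSteinhaus? n M ×-dec isMultiSymmetric? n M

allVecs : ∀ {A : Set} → List A → ∀ k → List (Vec A k)
allVecs xs zero    = [] ∷ []
allVecs xs (suc k) = concatMap (λ x → map (x ∷_) (allVecs xs k)) xs

allMatrices : ∀ n → List (Matrix n)
allMatrices n = allVecs (allVecs (false ∷ true ∷ []) n) n

MS : ℕ → ℕ
MS n = length (filter (isMSS? n) (allMatrices n))

-- In coordinates (a, b, c) with a + b + c = N, the entries above the diagonal
-- of a matrix of size N + 2 form a triangle, and a multi-symmetric Steinhaus
-- matrix is a function on it that is invariant under all permutations of the
-- coordinates and sums to 0 on every small upward triangle.  Such a function
-- vanishes at the points with two equal coordinates other than (0, b, b), and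
-- by induction on the largest coordinate it is determined by its values at
-- (0, b, b) and (N - 2b - 1, b, b + 1) for ⌈N/3⌉ ≤ b ≤ ⌊N/2⌋.  Conversely,
-- any choice of these values extends, by the same recursion on sorted points,
-- to a symmetric solution.  So MS(N + 2) = 2^(⌊N/2⌋ + 1 - ⌈N/3⌉), and this
-- exponent grows by 1 when N grows by 6.
module Submission where

open import Defs
open import Data.Nat using (ℕ; _+_; _^_; _/_; _%_; _≤_)
open import Data.Product using (_×_)
open import Relation.Binary.PropositionalEquality using (_≡_)

open import Data.Bool using (Bool; true; false; _xor_; _∧_; _∨_; if_then_else_)
open import Data.Bool.Properties using (xor-comm; xor-assoc; xor-same; xor-identityʳ; xor-∧-commutativeRing)
open import Data.Nat using (zero; suc; _∸_; _*_; _<_; _⊓_; _⊔_; z≤n; s≤s; _≟_; _<?_)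
open import Data.Nat.Properties
open import Data.Nat.DivMod
  using (m≡m%n+[m/n]*n; m%n<n; m*n/n≡m; m/n*n≤m; m<n*o⇒m/o<n)
  using (+-distrib-/-∣ʳ; +-distrib-/-∣ˡ; /-monoˡ-≤; /-monoʳ-≤)
open import Data.Nat.Divisibility using (divides)
open import Data.Fin using (Fin; toℕ; fromℕ<)
open import Data.Fin.Properties using (toℕ<n; toℕ-fromℕ<)
open import Data.Vec using (Vec; []; _∷_; head)
open import Data.List using (List; []; _∷_; map; concatMap; filter; length)
open import Data.List.Properties using (length-++; length-map)
open import Data.List.Relation.Unary.Any using (Any; here; there)
import Data.List.Relation.Unary.All as All
import Data.List.Relation.Unary.AllPairs as AllPairs
open import Data.List.Relation.Unary.Unique.Propositional using (Unique; []; _∷_)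
open import Data.List.Relation.Unary.Unique.Propositional.Properties
  using (++⁺; map⁺; filter⁺; Unique[x∷xs]⇒x∉xs)
open import Data.List.Membership.Propositional using (_∈_)
open import Data.List.Membership.Propositional.Properties
  using (∈-map⁺; ∈-map⁻; ∈-++⁻; ∈-concatMap⁺; ∈-filter⁺; ∈-filter⁻)
open import Data.List.Membership.Propositional.Properties.WithK using (unique∧set⇒bag)
open import Data.List.Relation.Binary.BagAndSetEquality using (_∼[_]_; set; ∼bag⇒↭)
open import Data.List.Relation.Binary.Permutation.Propositional.Properties using (↭-length)
open import Data.Product using (∃₂; _,_; proj₁; proj₂)
open import Data.Sum using (inj₁; inj₂)
open import Function using (_∘_)
open import Function.Bundles using (mk⇔)
open import Relation.Binary.PropositionalEquality
  using (_≢_; refl; sym; trans; cong; cong₂; subst; module ≡-Reasoning)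
open import Relation.Binary.Definitions using (tri<; tri≈; tri>)
open import Relation.Nullary using (yes; no; does)
open import Relation.Nullary.Decidable using (dec-true; dec-false)
open import Relation.Unary using (Pred; Decidable)
open import Level using (0ℓ)
open import Data.Nat.Solver using (module +-*-Solver)
open +-*-Solver using (solve; _:+_; _:*_; _:=_; con)
open import Algebra.Bundles using (CommutativeRing)
open import Algebra.Properties.CommutativeSemigroup +-commutativeSemigroup
  using () renaming (xy∙z≈xz∙y to +-swapʳ)
open import Algebra.Properties.CommutativeSemigroup
  (CommutativeRing.+-commutativeSemigroup xor-∧-commutativeRing)
  using () renaming (x∙yz≈y∙xz to xor-swapˡ; x∙yz≈x∙zy to xor-swapʳ)

module _ {A : Set} (xs : List A) where

  private
    head-∈-map : ∀ {k} x {v : Vec A (suc k)} (vs : List (Vec A k)) →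
                 v ∈ map (x ∷_) vs → head v ≡ x
    head-∈-map x vs p with ∈-map⁻ (x ∷_) p
    ... | _ , _ , refl = refl

    head-∈-prefixes : ∀ {k} ys {v : Vec A (suc k)} (vs : List (Vec A k)) →
                      v ∈ concatMap (λ y → map (y ∷_) vs) ys → head v ∈ ys
    head-∈-prefixes (y ∷ ys) vs p with ∈-++⁻ (map (y ∷_) vs) p
    ... | inj₁ q = here (head-∈-map y vs q)
    ... | inj₂ q = there (head-∈-prefixes ys vs q)

    ∷-injectiveʳ : ∀ {k} {x : A} {u v : Vec A k} → x ∷ u ≡ x ∷ v → u ≡ v
    ∷-injectiveʳ refl = refl

  allVecs-unique : Unique xs → ∀ k → Unique (allVecs xs k)
  allVecs-unique uxs zero    = All.[] ∷ []
  allVecs-unique uxs (suc k) = prefixes xs uxs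
    where
    vs = allVecs xs k
    prefixes : ∀ ys → Unique ys → Unique (concatMap (λ y → map (y ∷_) vs) ys)
    prefixes []       _   = []
    prefixes (y ∷ ys) uys = ++⁺ (map⁺ ∷-injectiveʳ (allVecs-unique uxs k)) (prefixes ys (AllPairs.tail uys))
      λ (p , q) → Unique[x∷xs]⇒x∉xs uys
                    (subst (_∈ ys) (head-∈-map y vs p) (head-∈-prefixes ys vs q))

  allVecs-complete : (∀ x → x ∈ xs) → ∀ k (v : Vec A k) → v ∈ allVecs xs k
  allVecs-complete all∈ zero    []      = here refl
  allVecs-complete all∈ (suc k) (x ∷ v) = ∈-concatMap⁺ (λ y → map (y ∷_) (allVecs xs k)) (heads xs (all∈ x))
    where
    heads : ∀ ys → x ∈ ys → Any (λ y → x ∷ v ∈ map (y ∷_) (allVecs xs k)) ys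
    heads (y ∷ ys) (here refl) = here (∈-map⁺ (x ∷_) (allVecs-complete all∈ k v))
    heads (y ∷ ys) (there p)   = there (heads ys p)

  length-allVecs : ∀ k → length (allVecs xs k) ≡ length xs ^ k
  length-allVecs zero    = refl
  length-allVecs (suc k) = prefixes xs
    where
    prefixes : ∀ ys → length (concatMap (λ y → map (y ∷_) (allVecs xs k)) ys) ≡ length ys * length xs ^ k
    prefixes []       = refl
    prefixes (y ∷ ys) = trans (length-++ (map (y ∷_) (allVecs xs k)))
      (cong₂ _+_ (trans (length-map (y ∷_) (allVecs xs k)) (length-allVecs k)) (prefixes ys))

length-filter-bijection :
  ∀ {A B : Set} {P : Pred A 0ℓ} (P? : Decidable P) (as : List A) (bs : List B) →
  Unique as → (∀ a → a ∈ as) → Unique bs → (∀ b → b ∈ bs) →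
  (to : B → A) (from : A → B) → (∀ b → P (to b)) →
  (∀ b → from (to b) ≡ b) → (∀ a → P a → to (from a) ≡ a) →
  length (filter P? as) ≡ length bs
length-filter-bijection {P = P} P? as bs uas all∈as ubs all∈bs to from P-to from∘to to∘from =
  trans (↭-length (∼bag⇒↭ (unique∧set⇒bag (filter⁺ P? uas) (map⁺ to-injective ubs) same-elements)))
        (length-map to bs)
  where
  to-injective : ∀ {x y} → to x ≡ to y → x ≡ y
  to-injective {x} {y} e = trans (sym (from∘to x)) (trans (cong from e) (from∘to y))
  same-elements : filter P? as ∼[ set ] map to bs
  same-elements {a} = mk⇔
    (λ p → subst (_∈ map to bs) (to∘from a (proj₂ (∈-filter⁻ P? {xs = as} p))) (∈-map⁺ to (all∈bs (from a))))
    (λ p → let (b , _ , e) = ∈-map⁻ to p in ∈-filter⁺ P? (all∈as a) (subst P (sym e) (P-to b)))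

tabulateℕ : ∀ {A : Set} k → (ℕ → A) → Vec A k
tabulateℕ zero    h = []
tabulateℕ (suc k) h = h 0 ∷ tabulateℕ k (h ∘ suc)

tabulateℕ-cong : ∀ {A : Set} k {g h : ℕ → A} → (∀ j → j < k → g j ≡ h j) →
                 tabulateℕ k g ≡ tabulateℕ k h
tabulateℕ-cong zero    g≗h = refl
tabulateℕ-cong (suc k) g≗h =
  cong₂ _∷_ (g≗h 0 (s≤s z≤n)) (tabulateℕ-cong k (λ j j<k → g≗h (suc j) (s≤s j<k)))

matrixℕ : ∀ m k → (ℕ → ℕ → Bool) → Vec (Vec Bool k) m
matrixℕ zero    k g = []
matrixℕ (suc m) k g = tabulateℕ k (g 0) ∷ matrixℕ m k (g ∘ suc)

entry-head-tabulateℕ : ∀ k h {m} (rs : Vec (Vec Bool k) m) j → j < k → entry (tabulateℕ k h ∷ rs) 0 j ≡ h j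
entry-head-tabulateℕ (suc k) h rs zero    _         = refl
entry-head-tabulateℕ (suc k) h rs (suc j) (s≤s j<k) = entry-head-tabulateℕ k (h ∘ suc) [] j j<k

tabulateℕ-entry-head : ∀ k (r : Vec Bool k) {m} (rs : Vec (Vec Bool k) m) → tabulateℕ k (entry (r ∷ rs) 0) ≡ r
tabulateℕ-entry-head zero    []       rs = refl
tabulateℕ-entry-head (suc k) (b ∷ bs) rs = cong (b ∷_) (tabulateℕ-entry-head k bs [])

entry-matrixℕ : ∀ m k g i j → i < m → j < k → entry (matrixℕ m k g) i j ≡ g i j
entry-matrixℕ (suc m) k g zero    j _         j<k = entry-head-tabulateℕ k (g 0) (matrixℕ m k (g ∘ suc)) j j<k
entry-matrixℕ (suc m) k g (suc i) j (s≤s i<m) j<k = entry-matrixℕ m k (g ∘ suc) i j i<m j<k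

matrixℕ-entry : ∀ m k (M : Vec (Vec Bool k) m) → matrixℕ m k (entry M) ≡ M
matrixℕ-entry zero    k []       = refl
matrixℕ-entry (suc m) k (r ∷ rs) = cong₂ _∷_ (tabulateℕ-entry-head k r rs) (matrixℕ-entry m k rs)

matrixℕ-cong : ∀ m k {g h} → (∀ i j → i < m → j < k → g i j ≡ h i j) → matrixℕ m k g ≡ matrixℕ m k h
matrixℕ-cong zero    k g≗h = refl
matrixℕ-cong (suc m) k g≗h = cong₂ _∷_ (tabulateℕ-cong k (λ j → g≗h 0 j (s≤s z≤n)))
  (matrixℕ-cong m k (λ i j i<m → g≗h (suc i) j (s≤s i<m)))

matrix-ext : ∀ n {M M′ : Matrix n} → (∀ i j → i < n → j < n → entry M i j ≡ entry M′ i j) → M ≡ M′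
matrix-ext n {M} {M′} M≗M′ =
  trans (sym (matrixℕ-entry n n M)) (trans (matrixℕ-cong n n M≗M′) (matrixℕ-entry n n M′))

module _ {n : ℕ} where

  Fin⇒bounded : (P : ℕ → Set) → (∀ (i : Fin n) → P (toℕ i)) → ∀ i → i < n → P i
  Fin⇒bounded P h i i<n = subst P (toℕ-fromℕ< i<n) (h (fromℕ< i<n))

  Fin⇒bounded₂ : (P : ℕ → ℕ → Set) → (∀ (i j : Fin n) → P (toℕ i) (toℕ j)) →
                 ∀ i j → i < n → j < n → P i j
  Fin⇒bounded₂ P h i j i<n j<n =
    Fin⇒bounded (P i) (Fin⇒bounded (λ i → ∀ (j : Fin n) → P i (toℕ j)) h i i<n) j j<n

  bounded⇒Fin : (P : ℕ → Set) → (∀ i → i < n → P i) → ∀ (i : Fin n) → P (toℕ i)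
  bounded⇒Fin P h i = h (toℕ i) (toℕ<n i)

  bounded⇒Fin₂ : (P : ℕ → ℕ → Set) → (∀ i j → i < n → j < n → P i j) →
                 ∀ (i j : Fin n) → P (toℕ i) (toℕ j)
  bounded⇒Fin₂ P h i j = h (toℕ i) (toℕ j) (toℕ<n i) (toℕ<n j)

xor-sum≡false⇒ : ∀ x y z → x xor y xor z ≡ false → z ≡ x xor y
xor-sum≡false⇒ false false false _ = refl
xor-sum≡false⇒ false true  true  _ = refl
xor-sum≡false⇒ true  false true  _ = refl
xor-sum≡false⇒ true  true  false _ = refl

xor-sum≡false⇐ : ∀ x y z → z ≡ x xor y → x xor y xor z ≡ false
xor-sum≡false⇐ x y _ refl = trans (sym (xor-assoc x y (x xor y))) (xor-same (x xor y))

wlog-sorted : (P : ℕ → ℕ → ℕ → Set) →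
  (∀ a b c → P a b c → P b a c) → (∀ a b c → P a b c → P a c b) →
  (∀ {a b c} → a ≤ b → b ≤ c → P a b c) → ∀ a b c → P a b c
wlog-sorted P swap₁₂ swap₂₃ sorted a b c with ≤-total a b | ≤-total b c | ≤-total a c
... | inj₁ a≤b | inj₁ b≤c | _        = sorted a≤b b≤c
... | inj₁ a≤b | inj₂ c≤b | inj₁ a≤c = swap₂₃ _ _ _ (sorted a≤c c≤b)
... | inj₁ a≤b | inj₂ c≤b | inj₂ c≤a = swap₂₃ _ _ _ (swap₁₂ _ _ _ (sorted c≤a a≤b))
... | inj₂ b≤a | inj₁ b≤c | inj₁ a≤c = swap₁₂ _ _ _ (sorted b≤a a≤c)
... | inj₂ b≤a | inj₁ b≤c | inj₂ c≤a = swap₁₂ _ _ _ (swap₂₃ _ _ _ (sorted b≤c c≤a))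
... | inj₂ b≤a | inj₂ c≤b | _        = swap₁₂ _ _ _ (swap₂₃ _ _ _ (swap₁₂ _ _ _ (sorted c≤b b≤a)))

-- A function on the points (a, b, c) of the triangle a + b + c = N; values
-- off the triangle are irrelevant.
Triangle : Set
Triangle = ℕ → ℕ → ℕ → Bool

record IsSymmetricSteinhausTriangle (N : ℕ) (f : Triangle) : Set where
  field
    triangle-sum : ∀ a b c → suc (a + b + c) ≡ N →
                   f (suc a) b c xor f a (suc b) c xor f a b (suc c) ≡ false
    swap₁₂ : ∀ a b c → a + b + c ≡ N → f a b c ≡ f b a c
    swap₂₃ : ∀ a b c → a + b + c ≡ N → f a b c ≡ f a c b

  rule : ∀ a b c → suc (a + b + c) ≡ N → f a b (suc c) ≡ f (suc a) b c xor f a (suc b) c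
  rule a b c s = xor-sum≡false⇒ (f (suc a) b c) (f a (suc b) c) _ (triangle-sum a b c s)

  -- On a symmetry axis the two terms of the rule coincide.
  vanishes-a-a-1+c : ∀ a c → a + a + suc c ≡ N → f a a (suc c) ≡ false
  vanishes-a-a-1+c a c s = begin
    f a a (suc c)                    ≡⟨ rule a a c s′ ⟩
    f (suc a) a c xor f a (suc a) c  ≡⟨ cong (_xor f a (suc a) c) (swap₁₂ (suc a) a c s′) ⟩
    f a (suc a) c xor f a (suc a) c  ≡⟨ xor-same (f a (suc a) c) ⟩
    false                            ∎
    where
    open ≡-Reasoning
    s′ = trans (sym (+-suc (a + a) c)) s

  vanishes-1+a-b-b : ∀ a b → suc a + b + b ≡ N → f (suc a) b b ≡ false
  vanishes-1+a-b-b a b s = begin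
    f (suc a) b b                                      ≡⟨ xor-identityʳ _ ⟨
    f (suc a) b b xor false                            ≡⟨ cong (f (suc a) b b xor_) (xor-same (f a b (suc b))) ⟨
    f (suc a) b b xor f a b (suc b) xor f a b (suc b)  ≡⟨ cong (λ x → f (suc a) b b xor x xor f a b (suc b))
                                                            (swap₂₃ a (suc b) b (trans (cong (_+ b) (+-suc a b)) s)) ⟨
    f (suc a) b b xor f a (suc b) b xor f a b (suc b)  ≡⟨ triangle-sum a b b s ⟩
    false                                              ∎
    where open ≡-Reasoning

IsFree : ℕ → ℕ → Set
IsFree N b = N ≤ b + b + b × b + b ≤ N

freeValue : ℕ → Triangle → ℕ → Bool
freeValue N f b = if does (b + b ≟ N) then f 0 b b else f (N ∸ suc (b + b)) b (suc b)

module _ {N : ℕ} (f : Triangle) (b : ℕ) where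

  freeValue-even : b + b ≡ N → freeValue N f b ≡ f 0 b b
  freeValue-even e rewrite dec-true (b + b ≟ N) e = refl

  freeValue-odd : b + b ≢ N → freeValue N f b ≡ f (N ∸ suc (b + b)) b (suc b)
  freeValue-odd e rewrite dec-false (b + b ≟ N) e = refl

module _ {N : ℕ} (lo m : ℕ) (s : lo + m + suc m ≡ N) where

  private
    s′ : lo + suc (m + m) ≡ N
    s′ = trans (sym (trans (+-assoc lo m (suc m)) (cong (lo +_) (+-suc m m)))) s

  freeValue-odd-point : ∀ f → freeValue N f m ≡ f lo m (suc m)
  freeValue-odd-point f = trans (freeValue-odd f m m+m≢N)
    (cong (λ x → f x m (suc m)) (trans (cong (_∸ suc (m + m)) (sym s′)) (m+n∸n≡m lo (suc (m + m)))))
    where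
    m+m≢N : m + m ≢ N
    m+m≢N e = <-irrefl (trans e (sym s′)) (m≤n+m (suc (m + m)) lo)

  odd-point-free : lo < m → IsFree N m
  odd-point-free lo<m = subst (_≤ m + m + m) s 3m-bound ,
                        subst (m + m ≤_) s′ (≤-trans (n≤1+n (m + m)) (m≤n+m (suc (m + m)) lo))
    where
    3m-bound : lo + m + suc m ≤ m + m + m
    3m-bound = begin
      lo + m + suc m      ≡⟨ +-suc (lo + m) m ⟩
      suc (lo + m + m)    ≡⟨ cong (λ x → suc (x + m)) (+-comm lo m) ⟩
      suc (m + lo + m)    ≡⟨ cong suc (+-assoc m lo m) ⟩
      suc (m + (lo + m))  ≡⟨ +-suc m (lo + m) ⟨
      m + suc (lo + m)    ≤⟨ +-monoʳ-≤ m (+-monoˡ-≤ m lo<m) ⟩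
      m + (m + m)         ≡⟨ +-assoc m m m ⟨
      m + m + m           ∎
      where open ≤-Reasoning

even-point-free : ∀ {N} m → m + m ≡ N → IsFree N m
even-point-free m refl = m≤m+n (m + m) m , ≤-refl

module _ {N : ℕ} {f g : Triangle}
         (F : IsSymmetricSteinhausTriangle N f) (G : IsSymmetricSteinhausTriangle N g)
         (agree : ∀ b → IsFree N b → freeValue N f b ≡ freeValue N g b) where

  private
    module F = IsSymmetricSteinhausTriangle F
    module G = IsSymmetricSteinhausTriangle G

    agree-even : ∀ m → m + m ≡ N → f 0 m m ≡ g 0 m m
    agree-even m s = trans (sym (freeValue-even f m s))
      (trans (agree m (even-point-free m s)) (freeValue-even g m s))

    agree-odd : ∀ lo m → lo < m → lo + m + suc m ≡ N → f lo m (suc m) ≡ g lo m (suc m)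
    agree-odd lo m lo<m s = trans (sym (freeValue-odd-point lo m s f))
      (trans (agree m (odd-point-free lo m s lo<m)) (freeValue-odd-point lo m s g))

    -- Induction on the largest coordinate: the rule expresses f lo m (1 + h)
    -- through two sorted points with largest coordinate h.
    agree-sorted : ∀ hi lo m → lo ≤ m → m ≤ hi → lo + m + hi ≡ N → f lo m hi ≡ g lo m hi
    agree-sorted zero .zero .zero z≤n z≤n s = agree-even 0 s
    agree-sorted (suc h) lo m lo≤m m≤hi s with lo ≟ m | m ≟ suc h | suc h ≟ suc m
    ... | yes refl | _        | _        = trans (F.vanishes-a-a-1+c lo h s) (sym (G.vanishes-a-a-1+c lo h s))
    ... | no _     | yes refl | _        with lo
    ...   | zero  = agree-even m s
    ...   | suc a = trans (F.vanishes-1+a-b-b a m s) (sym (G.vanishes-1+a-b-b a m s))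
    agree-sorted (suc h) lo m lo≤m m≤hi s | no lo≢m | no _ | yes refl = agree-odd lo m (≤∧≢⇒< lo≤m lo≢m) s
    agree-sorted (suc h) lo m lo≤m m≤hi s | no lo≢m | no m≢hi | no hi≢1+m = begin
      f lo m (suc h)                        ≡⟨ F.rule lo m h s′ ⟩
      f (suc lo) m h xor f lo (suc m) h     ≡⟨ cong₂ _xor_ IH₁ IH₂ ⟩
      g (suc lo) m h xor g lo (suc m) h     ≡⟨ G.rule lo m h s′ ⟨
      g lo m (suc h)                        ∎
      where
      open ≡-Reasoning
      s′ = trans (sym (+-suc (lo + m) h)) s
      m≤h = ≤-pred (≤∧≢⇒< m≤hi m≢hi)
      IH₁ = agree-sorted h (suc lo) m (≤∧≢⇒< lo≤m lo≢m) m≤h s′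
      IH₂ = agree-sorted h lo (suc m) (m≤n⇒m≤1+n lo≤m) (≤∧≢⇒< m≤h (hi≢1+m ∘ cong suc ∘ sym))
              (trans (cong (_+ h) (+-suc lo m)) s′)

  triangle-unique : ∀ a b c → a + b + c ≡ N → f a b c ≡ g a b c
  triangle-unique = wlog-sorted (λ a b c → a + b + c ≡ N → f a b c ≡ g a b c)
    (λ a b c P s → let s′ = trans (cong (_+ c) (+-comm a b)) s in
       trans (F.swap₁₂ b a c s) (trans (P s′) (sym (G.swap₁₂ b a c s))))
    (λ a b c P s → let s′ = trans (+-swapʳ a b c) s in
       trans (F.swap₂₃ a c b s) (trans (P s′) (sym (G.swap₂₃ a c b s))))
    (λ a≤b b≤c → agree-sorted _ _ _ a≤b b≤c)

odd-point-on-triangle : ∀ {N b} → b + b ≤ N → b + b ≢ N → N ∸ suc (b + b) + b + suc b ≡ N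
odd-point-on-triangle {N} {b} b+b≤N b+b≢N = begin
  N ∸ suc (b + b) + b + suc b    ≡⟨ +-assoc (N ∸ suc (b + b)) b (suc b) ⟩
  N ∸ suc (b + b) + (b + suc b)  ≡⟨ cong (N ∸ suc (b + b) +_) (+-suc b b) ⟩
  N ∸ suc (b + b) + suc (b + b)  ≡⟨ m∸n+n≡m (≤∧≢⇒< b+b≤N b+b≢N) ⟩
  N                              ∎
  where open ≡-Reasoning

odd-free-point-below : ∀ {N b} → N ≤ b + b + b → b + b ≤ N → b + b ≢ N → N ∸ suc (b + b) < b
odd-free-point-below {N} {b} N≤3b b+b≤N b+b≢N = +-cancelʳ-≤ (b + b) (suc (N ∸ suc (b + b))) b (begin
  suc (N ∸ suc (b + b) + (b + b))  ≡⟨ +-suc (N ∸ suc (b + b)) (b + b) ⟨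
  N ∸ suc (b + b) + suc (b + b)    ≡⟨ m∸n+n≡m (≤∧≢⇒< b+b≤N b+b≢N) ⟩
  N                                ≤⟨ N≤3b ⟩
  b + b + b                        ≡⟨ +-assoc b b b ⟩
  b + (b + b)                      ∎)
  where open ≤-Reasoning

freeValue-cong : ∀ {N f g} → (∀ a b c → a + b + c ≡ N → f a b c ≡ g a b c) →
                 ∀ b → b + b ≤ N → freeValue N f b ≡ freeValue N g b
freeValue-cong {N} {f} {g} f≗g b b+b≤N with b + b ≟ N
... | yes e = trans (freeValue-even f b e) (trans (f≗g 0 b b e) (sym (freeValue-even g b e)))
... | no ne = trans (freeValue-odd-point _ b s f) (trans (f≗g _ b (suc b) s) (sym (freeValue-odd-point _ b s g)))
  where s = odd-point-on-triangle b+b≤N ne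

-- The value of the extension of π at a sorted point lo ≤ m ≤ hi: π m at the
-- free points (0, m, m) and (lo, m, m + 1), false at the other points with two
-- equal coordinates, and otherwise r, the value forced by the rule.
pointValue : (ℕ → Bool) → ℕ → ℕ → ℕ → Bool → Bool
pointValue π lo m hi r =
  if does (m ≟ hi) ∧ does (lo ≟ 0) then π m
  else if does (m ≟ hi) ∨ does (lo ≟ m) then false
  else if does (hi ≟ suc m) then π m
  else r

module _ (π : ℕ → Bool) where

  pointValue-0-b-b : ∀ b r → pointValue π 0 b b r ≡ π b
  pointValue-0-b-b b r rewrite dec-true (b ≟ b) refl = refl

  pointValue-a-a : ∀ a hi r → a ≢ hi → pointValue π a a hi r ≡ false
  pointValue-a-a a hi r a≢hi rewrite dec-false (a ≟ hi) a≢hi | dec-true (a ≟ a) refl = refl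

  pointValue-1+a-b-b : ∀ a b r → pointValue π (suc a) b b r ≡ false
  pointValue-1+a-b-b a b r rewrite dec-true (b ≟ b) refl = refl

  pointValue-odd : ∀ lo m r → lo ≢ m → pointValue π lo m (suc m) r ≡ π m
  pointValue-odd lo m r lo≢m
    rewrite dec-false (m ≟ suc m) (1+n≢n ∘ sym) | dec-false (lo ≟ m) lo≢m | dec-true (suc m ≟ suc m) refl = refl

  pointValue-rule : ∀ lo m hi r → lo ≢ m → m ≢ hi → hi ≢ suc m → pointValue π lo m hi r ≡ r
  pointValue-rule lo m hi r lo≢m m≢hi hi≢1+m
    rewrite dec-false (m ≟ hi) m≢hi | dec-false (lo ≟ m) lo≢m | dec-false (hi ≟ suc m) hi≢1+m = refl

  -- Indexed by the smallest and largest coordinate; the middle one is N - lo - hi.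
  sortedValue : ℕ → ℕ → ℕ → Bool
  ruleValue   : ℕ → ℕ → ℕ → Bool

  sortedValue N lo hi = pointValue π lo (N ∸ lo ∸ hi) hi (ruleValue N lo hi)

  ruleValue N lo zero    = false
  ruleValue N lo (suc h) = sortedValue N (suc lo) h xor sortedValue N lo h

  sortedValue-unfold : ∀ {N} lo m hi → lo + m + hi ≡ N →
                       sortedValue N lo hi ≡ pointValue π lo m hi (ruleValue N lo hi)
  sortedValue-unfold {N} lo m hi s =
    cong (λ x → pointValue π lo x hi (ruleValue N lo hi)) (begin
      N ∸ lo ∸ hi              ≡⟨ cong (λ x → x ∸ lo ∸ hi) s ⟨
      lo + m + hi ∸ lo ∸ hi    ≡⟨ cong (λ x → x ∸ lo ∸ hi) (+-assoc lo m hi) ⟩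
      lo + (m + hi) ∸ lo ∸ hi  ≡⟨ cong (_∸ hi) (m+n∸m≡n lo (m + hi)) ⟩
      m + hi ∸ hi              ≡⟨ m+n∸n≡m m hi ⟩
      m                        ∎)
    where open ≡-Reasoning

  extend : ℕ → Triangle
  extend N a b c = sortedValue N (a ⊓ b ⊓ c) (a ⊔ b ⊔ c)

  module _ (N : ℕ) where

    extend-swap₁₂ : ∀ a b c → extend N a b c ≡ extend N b a c
    extend-swap₁₂ a b c = cong₂ (sortedValue N) (cong (_⊓ c) (⊓-comm a b)) (cong (_⊔ c) (⊔-comm a b))

    extend-swap₂₃ : ∀ a b c → extend N a b c ≡ extend N a c b
    extend-swap₂₃ a b c = cong₂ (sortedValue N)
      (trans (⊓-assoc a b c) (trans (cong (a ⊓_) (⊓-comm b c)) (sym (⊓-assoc a c b))))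
      (trans (⊔-assoc a b c) (trans (cong (a ⊔_) (⊔-comm b c)) (sym (⊔-assoc a c b))))

    extend-sorted : ∀ {a b c} → a ≤ b → b ≤ c → extend N a b c ≡ sortedValue N a c
    extend-sorted {a} {b} {c} a≤b b≤c = cong₂ (sortedValue N)
      (trans (cong (_⊓ c) (m≤n⇒m⊓n≡m a≤b)) (m≤n⇒m⊓n≡m (≤-trans a≤b b≤c)))
      (trans (cong (_⊔ c) (m≤n⇒m⊔n≡n a≤b)) (m≤n⇒m⊔n≡n b≤c))

    private
      F = extend N

      TriangleSum : ℕ → ℕ → ℕ → Set
      TriangleSum a b c = suc (a + b + c) ≡ N → F (suc a) b c xor F a (suc b) c xor F a b (suc c) ≡ false

      triangle-sum-sorted : ∀ {a b c} → a ≤ b → b ≤ c → TriangleSum a b c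
      triangle-sum-sorted {a} {b} {c} a≤b b≤c s with a ≟ b | b ≟ c
      ... | yes refl | _ = begin
        F (suc a) a c xor F a (suc a) c xor F a a (suc c)
          ≡⟨ cong (_xor F a (suc a) c xor F a a (suc c)) (extend-swap₁₂ (suc a) a c) ⟩
        F a (suc a) c xor F a (suc a) c xor F a a (suc c)  ≡⟨ xor-assoc (F a (suc a) c) _ _ ⟨
        (F a (suc a) c xor F a (suc a) c) xor F a a (suc c) ≡⟨ cong (_xor F a a (suc c)) (xor-same (F a (suc a) c)) ⟩
        F a a (suc c)                                      ≡⟨ extend-sorted ≤-refl (m≤n⇒m≤1+n b≤c) ⟩
        sortedValue N a (suc c)                            ≡⟨ sortedValue-unfold a a (suc c) (trans (+-suc (a + a) c) s) ⟩
        pointValue π a a (suc c) _                         ≡⟨ pointValue-a-a a (suc c) _ (<⇒≢ (s≤s b≤c)) ⟩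
        false                                              ∎
        where open ≡-Reasoning
      ... | no a≢b | yes refl = begin
        F (suc a) b b xor F a (suc b) b xor F a b (suc b)
          ≡⟨ cong (λ x → F (suc a) b b xor x xor F a b (suc b)) (extend-swap₂₃ a (suc b) b) ⟩
        F (suc a) b b xor F a b (suc b) xor F a b (suc b)  ≡⟨ cong (F (suc a) b b xor_) (xor-same (F a b (suc b))) ⟩
        F (suc a) b b xor false                            ≡⟨ xor-identityʳ _ ⟩
        F (suc a) b b                                      ≡⟨ extend-sorted (≤∧≢⇒< a≤b a≢b) ≤-refl ⟩
        sortedValue N (suc a) b                            ≡⟨ sortedValue-unfold (suc a) b b s ⟩
        pointValue π (suc a) b b _                         ≡⟨ pointValue-1+a-b-b a b _ ⟩
        false                                              ∎
        where open ≡-Reasoning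
      ... | no a≢b | no b≢c = begin
        F (suc a) b c xor F a (suc b) c xor F a b (suc c)
          ≡⟨ cong₂ (λ x y → x xor y xor F a b (suc c))
                   (extend-sorted (≤∧≢⇒< a≤b a≢b) b≤c)
                   (extend-sorted (m≤n⇒m≤1+n a≤b) (≤∧≢⇒< b≤c b≢c)) ⟩
        sortedValue N (suc a) c xor sortedValue N a c xor F a b (suc c)
          ≡⟨ cong (λ x → sortedValue N (suc a) c xor sortedValue N a c xor x) F[a,b,1+c]≡rule ⟩
        sortedValue N (suc a) c xor sortedValue N a c xor (sortedValue N (suc a) c xor sortedValue N a c)
          ≡⟨ xor-assoc (sortedValue N (suc a) c) _ _ ⟨
        (sortedValue N (suc a) c xor sortedValue N a c) xor (sortedValue N (suc a) c xor sortedValue N a c)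
          ≡⟨ xor-same (sortedValue N (suc a) c xor sortedValue N a c) ⟩
        false ∎
        where
        open ≡-Reasoning
        F[a,b,1+c]≡rule : F a b (suc c) ≡ ruleValue N a (suc c)
        F[a,b,1+c]≡rule = trans (extend-sorted a≤b (m≤n⇒m≤1+n b≤c))
          (trans (sortedValue-unfold a b (suc c) (trans (+-suc (a + b) c) s))
                 (pointValue-rule a b (suc c) _ a≢b (<⇒≢ (s≤s b≤c)) (b≢c ∘ sym ∘ suc-injective)))

    extend-symmetric : IsSymmetricSteinhausTriangle N F
    extend-symmetric = record
      { triangle-sum = wlog-sorted TriangleSum swap₁₂ swap₂₃ triangle-sum-sorted
      ; swap₁₂ = λ a b c _ → extend-swap₁₂ a b c
      ; swap₂₃ = λ a b c _ → extend-swap₂₃ a b c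
      }
      where
      swap₁₂ : ∀ a b c → TriangleSum a b c → TriangleSum b a c
      swap₁₂ a b c P s = begin
        F (suc b) a c xor F b (suc a) c xor F b a (suc c)
          ≡⟨ cong₂ (λ x y → x xor y xor F b a (suc c))
                   (extend-swap₁₂ (suc b) a c) (extend-swap₁₂ b (suc a) c) ⟩
        F a (suc b) c xor F (suc a) b c xor F b a (suc c)
          ≡⟨ cong (λ x → F a (suc b) c xor F (suc a) b c xor x) (extend-swap₁₂ b a (suc c)) ⟩
        F a (suc b) c xor F (suc a) b c xor F a b (suc c)  ≡⟨ xor-swapˡ (F a (suc b) c) (F (suc a) b c) (F a b (suc c)) ⟩
        F (suc a) b c xor F a (suc b) c xor F a b (suc c)  ≡⟨ P (trans (cong (λ x → suc (x + c)) (+-comm a b)) s) ⟩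
        false                                              ∎
        where open ≡-Reasoning
      swap₂₃ : ∀ a b c → TriangleSum a b c → TriangleSum a c b
      swap₂₃ a b c P s = begin
        F (suc a) c b xor F a (suc c) b xor F a c (suc b)
          ≡⟨ cong₂ (λ x y → x xor y xor F a c (suc b))
                   (extend-swap₂₃ (suc a) c b) (extend-swap₂₃ a (suc c) b) ⟩
        F (suc a) b c xor F a b (suc c) xor F a c (suc b)
          ≡⟨ cong (λ x → F (suc a) b c xor F a b (suc c) xor x) (extend-swap₂₃ a c (suc b)) ⟩
        F (suc a) b c xor F a b (suc c) xor F a (suc b) c  ≡⟨ xor-swapʳ (F (suc a) b c) (F a b (suc c)) (F a (suc b) c) ⟩
        F (suc a) b c xor F a (suc b) c xor F a b (suc c)  ≡⟨ P (trans (cong suc (+-swapʳ a b c)) s) ⟩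
        false                                              ∎
        where open ≡-Reasoning

    extend-free : ∀ b → IsFree N b → freeValue N F b ≡ π b
    extend-free b (N≤3b , b+b≤N) with b + b ≟ N
    ... | yes e = begin
      freeValue N F b       ≡⟨ freeValue-even F b e ⟩
      F 0 b b               ≡⟨ extend-sorted {b = b} z≤n ≤-refl ⟩
      sortedValue N 0 b     ≡⟨ sortedValue-unfold 0 b b e ⟩
      pointValue π 0 b b _  ≡⟨ pointValue-0-b-b b _ ⟩
      π b                   ∎
      where open ≡-Reasoning
    ... | no ne = begin
      freeValue N F b                ≡⟨ freeValue-odd-point lo b s F ⟩
      F lo b (suc b)                 ≡⟨ extend-sorted (<⇒≤ lo<b) (n≤1+n b) ⟩
      sortedValue N lo (suc b)       ≡⟨ sortedValue-unfold lo b (suc b) s ⟩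
      pointValue π lo b (suc b) _    ≡⟨ pointValue-odd lo b _ (<⇒≢ lo<b) ⟩
      π b                            ∎
      where
      open ≡-Reasoning
      lo = N ∸ suc (b + b)
      s : lo + b + suc b ≡ N
      s = odd-point-on-triangle b+b≤N ne
      lo<b : lo < b
      lo<b = odd-free-point-below N≤3b b+b≤N ne

-- Entry (i, j), i < j, of a matrix of size N + 2 is the point
-- (j - i - 1, N + 1 - j, i) of the triangle, i.e. its distances to the
-- diagonal, to the last column and to the first row.  The Steinhaus rule
-- becomes the triangle sum, double symmetry swaps the last two coordinates
-- and multi-symmetry the first two.
atPoint : ∀ {n} → Matrix n → Triangle
atPoint M a b c = entry M c (c + suc a)

m+n≡o⇒o∸m≡n : ∀ m {n o} → m + n ≡ o → o ∸ m ≡ n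
m+n≡o⇒o∸m≡n m {n} refl = m+n∸m≡n m n

upper-coordinates : ∀ N {i j} → i < j → j < 2 + N → ∃₂ λ a b → j ≡ i + suc a × a + b + i ≡ N
upper-coordinates N {i} i<j j<n with m≤n⇒∃[o]m+o≡n i<j | m≤n⇒∃[o]m+o≡n (≤-pred j<n)
... | a , refl | b , e = a , b , sym (+-suc i a) ,
  suc-injective (trans (solve 3 (λ a b i → con 1 :+ (a :+ b :+ i) := con 1 :+ i :+ a :+ b) refl a b i) e)

module Coordinates {N : ℕ} (a b c : ℕ) (s : a + b + c ≡ N) where

  column+b : c + suc a + b ≡ suc N
  column+b = trans (solve 3 (λ a b c → c :+ (con 1 :+ a) :+ b := con 1 :+ (a :+ b :+ c)) refl a b c) (cong suc s)

  N+1∸column : suc N ∸ (c + suc a) ≡ b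
  N+1∸column = m+n≡o⇒o∸m≡n (c + suc a) column+b

  N+2∸column : 2 + N ∸ (c + suc a) ≡ suc b
  N+2∸column = m+n≡o⇒o∸m≡n (c + suc a) (trans (+-suc (c + suc a) b) (cong suc column+b))

  N+1∸row : suc N ∸ c ≡ b + suc a
  N+1∸row = m+n≡o⇒o∸m≡n c
    (trans (solve 3 (λ a b c → c :+ (b :+ (con 1 :+ a)) := c :+ (con 1 :+ a) :+ b) refl a b c) column+b)

  column<n : c + suc a < 2 + N
  column<n = s≤s (subst (c + suc a ≤_) column+b (m≤m+n (c + suc a) b))

  row<n : c < 2 + N
  row<n = <-trans (m<m+n c (s≤s z≤n)) column<n

module _ (N : ℕ) (P : ℕ → ℕ → Set)
         (diagonal : ∀ i → i < 2 + N → P i i)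
         (above : ∀ a b c → a + b + c ≡ N → P c (c + suc a))
         (below : ∀ a b c → a + b + c ≡ N → P (c + suc a) c) where

  matrix-index-cases : ∀ i j → i < 2 + N → j < 2 + N → P i j
  matrix-index-cases i j i<n j<n with <-cmp i j
  ... | tri< i<j _ _ with upper-coordinates N i<j j<n
  ...   | a , b , refl , s = above a b i s
  matrix-index-cases i j i<n j<n | tri≈ _ refl _ = diagonal i i<n
  matrix-index-cases i j i<n j<n | tri> _ _ j<i with upper-coordinates N j<i i<n
  ...   | a , b , refl , s = below a b j s

entryOf : ℕ → Triangle → ℕ → ℕ → Bool
entryOf N f i j =
  if does (i <? j) then f (j ∸ suc i) (suc N ∸ j) i
  else if does (j <? i) then f (i ∸ suc j) (suc N ∸ i) j
  else false

matrixOf : ∀ N → Triangle → Matrix (2 + N)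
matrixOf N f = matrixℕ (2 + N) (2 + N) (entryOf N f)

module _ {N : ℕ} (f : Triangle) where

  private
    entryOf-above : ∀ a b c → a + b + c ≡ N → entryOf N f c (c + suc a) ≡ f a b c
    entryOf-above a b c s rewrite dec-true (c <? c + suc a) (m<m+n c (s≤s z≤n)) =
      cong₂ (λ x y → f x y c) (m+n≡o⇒o∸m≡n (suc c) (sym (+-suc c a))) (Coordinates.N+1∸column a b c s)

    entryOf-below : ∀ a b c → a + b + c ≡ N → entryOf N f (c + suc a) c ≡ f a b c
    entryOf-below a b c s
      rewrite dec-false (c + suc a <? c) (<⇒≯ (m<m+n c (s≤s z≤n))) | dec-true (c <? c + suc a) (m<m+n c (s≤s z≤n)) =
      cong₂ (λ x y → f x y c) (m+n≡o⇒o∸m≡n (suc c) (sym (+-suc c a))) (Coordinates.N+1∸column a b c s)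

  entry-matrixOf-above : ∀ a b c → a + b + c ≡ N → entry (matrixOf N f) c (c + suc a) ≡ f a b c
  entry-matrixOf-above a b c s =
    trans (entry-matrixℕ (2 + N) (2 + N) (entryOf N f) c (c + suc a) row<n column<n) (entryOf-above a b c s)
    where open Coordinates a b c s

  entry-matrixOf-below : ∀ a b c → a + b + c ≡ N → entry (matrixOf N f) (c + suc a) c ≡ f a b c
  entry-matrixOf-below a b c s =
    trans (entry-matrixℕ (2 + N) (2 + N) (entryOf N f) (c + suc a) c column<n row<n) (entryOf-below a b c s)
    where open Coordinates a b c s

  entry-matrixOf-diagonal : ∀ i → i < 2 + N → entry (matrixOf N f) i i ≡ false
  entry-matrixOf-diagonal i i<n = trans (entry-matrixℕ (2 + N) (2 + N) (entryOf N f) i i i<n i<n) diagonal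
    where
    diagonal : entryOf N f i i ≡ false
    diagonal rewrite dec-false (i <? i) (<-irrefl refl) = refl

matrixOf-cong : ∀ N {f g} → (∀ a b c → a + b + c ≡ N → f a b c ≡ g a b c) → matrixOf N f ≡ matrixOf N g
matrixOf-cong N {f} {g} f≗g = matrix-ext (2 + N) (matrix-index-cases N
  (λ i j → entry (matrixOf N f) i j ≡ entry (matrixOf N g) i j)
  (λ i i<n → trans (entry-matrixOf-diagonal f i i<n) (sym (entry-matrixOf-diagonal g i i<n)))
  (λ a b c s → trans (entry-matrixOf-above f a b c s) (trans (f≗g a b c s) (sym (entry-matrixOf-above g a b c s))))
  (λ a b c s → trans (entry-matrixOf-below f a b c s) (trans (f≗g a b c s) (sym (entry-matrixOf-below g a b c s)))))

module _ {N : ℕ} (M : Matrix (2 + N)) (mss : IsMultiSymmetricSteinhaus (2 + N) M) where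

  private
    n = 2 + N
    e = entry M

    zero-diagonal : ∀ i → i < n → e i i ≡ false
    zero-diagonal = Fin⇒bounded (λ i → e i i ≡ false) (proj₁ (proj₁ mss))

    steinhaus-rule : ∀ i j → i < n → j < n → 1 ≤ i → i < j → e i j ≡ e (i ∸ 1) (j ∸ 1) xor e (i ∸ 1) j
    steinhaus-rule = Fin⇒bounded₂ (λ i j → 1 ≤ i → i < j → e i j ≡ e (i ∸ 1) (j ∸ 1) xor e (i ∸ 1) j)
                       (proj₁ (proj₂ (proj₁ mss)))

    symmetric : ∀ i j → i < n → j < n → e i j ≡ e j i
    symmetric = Fin⇒bounded₂ (λ i j → e i j ≡ e j i) (proj₂ (proj₂ (proj₁ mss)))

    antidiagonal-symmetric : ∀ i j → i < n → j < n → e j i ≡ e (suc N ∸ j) (suc N ∸ i)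
    antidiagonal-symmetric = Fin⇒bounded₂ (λ i j → e j i ≡ e (suc N ∸ j) (suc N ∸ i))
                               (λ i j → proj₂ (proj₁ (proj₂ mss) i j))

    row-symmetric : ∀ i j → i < n → j < n → i < j → e i j ≡ e i (n ∸ j + i)
    row-symmetric = Fin⇒bounded₂ (λ i j → i < j → e i j ≡ e i (n ∸ j + i)) (proj₂ (proj₂ mss))

  atPoint-symmetric : IsSymmetricSteinhausTriangle N (atPoint M)
  atPoint-symmetric = record { triangle-sum = triangle-sum ; swap₁₂ = swap₁₂ ; swap₂₃ = swap₂₃ }
    where
    triangle-sum : ∀ a b c → suc (a + b + c) ≡ N →
                   atPoint M (suc a) b c xor atPoint M a (suc b) c xor atPoint M a b (suc c) ≡ false
    triangle-sum a b c s = xor-sum≡false⇐ (e c (c + suc (suc a))) (e c (c + suc a)) _ (begin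
      e (suc c) (suc c + suc a)
        ≡⟨ steinhaus-rule (suc c) (suc c + suc a) row<n column<n (s≤s z≤n) (m<m+n (suc c) (s≤s z≤n)) ⟩
      e c (c + suc a) xor e c (suc c + suc a)     ≡⟨ xor-comm (e c (c + suc a)) _ ⟩
      e c (suc c + suc a) xor e c (c + suc a)     ≡⟨ cong (λ x → e c x xor e c (c + suc a)) (+-suc c (suc a)) ⟨
      e c (c + suc (suc a)) xor e c (c + suc a)   ∎)
      where
      open ≡-Reasoning
      open Coordinates a b (suc c) (trans (+-suc (a + b) c) s)

    swap₁₂ : ∀ a b c → a + b + c ≡ N → atPoint M a b c ≡ atPoint M b a c
    swap₁₂ a b c s = begin
      e c (c + suc a)           ≡⟨ row-symmetric c (c + suc a) row<n column<n (m<m+n c (s≤s z≤n)) ⟩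
      e c (n ∸ (c + suc a) + c) ≡⟨ cong (λ x → e c (x + c)) N+2∸column ⟩
      e c (suc b + c)           ≡⟨ cong (e c) (+-comm (suc b) c) ⟩
      e c (c + suc b)           ∎
      where
      open ≡-Reasoning
      open Coordinates a b c s

    swap₂₃ : ∀ a b c → a + b + c ≡ N → atPoint M a b c ≡ atPoint M a c b
    swap₂₃ a b c s = begin
      e c (c + suc a)                        ≡⟨ symmetric c (c + suc a) row<n column<n ⟩
      e (c + suc a) c                        ≡⟨ antidiagonal-symmetric c (c + suc a) row<n column<n ⟩
      e (suc N ∸ (c + suc a)) (suc N ∸ c)    ≡⟨ cong₂ e N+1∸column N+1∸row ⟩
      e b (b + suc a)                        ∎
      where
      open ≡-Reasoning
      open Coordinates a b c s

  matrixOf-atPoint : matrixOf N (atPoint M) ≡ M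
  matrixOf-atPoint = matrix-ext n (matrix-index-cases N
    (λ i j → entry (matrixOf N (atPoint M)) i j ≡ e i j)
    (λ i i<n → trans (entry-matrixOf-diagonal (atPoint M) i i<n) (sym (zero-diagonal i i<n)))
    (λ a b c s → entry-matrixOf-above (atPoint M) a b c s)
    (λ a b c s → let open Coordinates a b c s in
       trans (entry-matrixOf-below (atPoint M) a b c s) (symmetric c (c + suc a) row<n column<n)))

module _ {N : ℕ} {f : Triangle} (F : IsSymmetricSteinhausTriangle N f) where

  private
    open IsSymmetricSteinhausTriangle F
    n = 2 + N
    e = entry (matrixOf N f)

    symmetric : ∀ i j → i < n → j < n → e i j ≡ e j i
    symmetric = matrix-index-cases N (λ i j → e i j ≡ e j i) (λ _ _ → refl)
      (λ a b c s → trans (entry-matrixOf-above f a b c s) (sym (entry-matrixOf-below f a b c s)))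
      (λ a b c s → trans (entry-matrixOf-below f a b c s) (sym (entry-matrixOf-above f a b c s)))

    steinhaus-rule : ∀ i j → i < n → j < n → 1 ≤ i → i < j → e i j ≡ e (i ∸ 1) (j ∸ 1) xor e (i ∸ 1) j
    steinhaus-rule (suc c) j i<n j<n _ i<j with upper-coordinates N i<j j<n
    ... | a , b , refl , s = begin
      e (suc c) (suc c + suc a)                ≡⟨ entry-matrixOf-above f a b (suc c) s ⟩
      f a b (suc c)                            ≡⟨ rule a b c s′ ⟩
      f (suc a) b c xor f a (suc b) c          ≡⟨ xor-comm (f (suc a) b c) _ ⟩
      f a (suc b) c xor f (suc a) b c          ≡⟨ cong₂ _xor_ (entry-matrixOf-above f a (suc b) c s″)
                                                    (entry-matrixOf-above f (suc a) b c s′) ⟨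
      e c (c + suc a) xor e c (c + suc (suc a)) ≡⟨ cong (λ x → e c (c + suc a) xor e c x) (+-suc c (suc a)) ⟩
      e c (c + suc a) xor e c (suc c + suc a)  ∎
      where
      open ≡-Reasoning
      s′ = trans (sym (+-suc (a + b) c)) s
      s″ = trans (cong (_+ c) (+-suc a b)) s′

    antidiagonal-symmetric : ∀ i j → i < n → j < n → e j i ≡ e (suc N ∸ j) (suc N ∸ i)
    antidiagonal-symmetric = matrix-index-cases N (λ i j → e j i ≡ e (suc N ∸ j) (suc N ∸ i))
      (λ i i<n → trans (entry-matrixOf-diagonal f i i<n)
                       (sym (entry-matrixOf-diagonal f (suc N ∸ i) (s≤s (m∸n≤m (suc N) i)))))
      (λ a b c s → let open Coordinates a b c s in begin
         e (c + suc a) c                      ≡⟨ entry-matrixOf-below f a b c s ⟩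
         f a b c                              ≡⟨ swap₂₃ a b c s ⟩
         f a c b                              ≡⟨ entry-matrixOf-above f a c b (trans (+-swapʳ a c b) s) ⟨
         e b (b + suc a)                      ≡⟨ cong₂ e N+1∸column N+1∸row ⟨
         e (suc N ∸ (c + suc a)) (suc N ∸ c)  ∎)
      (λ a b c s → let open Coordinates a b c s in begin
         e c (c + suc a)                      ≡⟨ entry-matrixOf-above f a b c s ⟩
         f a b c                              ≡⟨ swap₂₃ a b c s ⟩
         f a c b                              ≡⟨ entry-matrixOf-below f a c b (trans (+-swapʳ a c b) s) ⟨
         e (b + suc a) b                      ≡⟨ cong₂ e N+1∸row N+1∸column ⟨
         e (suc N ∸ c) (suc N ∸ (c + suc a))  ∎)
      where open ≡-Reasoning

    row-symmetric : ∀ i j → i < n → j < n → i < j → e i j ≡ e i (n ∸ j + i)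
    row-symmetric i j i<n j<n i<j with upper-coordinates N i<j j<n
    ... | a , b , refl , s = begin
      e i (i + suc a)            ≡⟨ entry-matrixOf-above f a b i s ⟩
      f a b i                    ≡⟨ swap₁₂ a b i s ⟩
      f b a i                    ≡⟨ entry-matrixOf-above f b a i (trans (cong (_+ i) (+-comm b a)) s) ⟨
      e i (i + suc b)            ≡⟨ cong (e i) (+-comm i (suc b)) ⟩
      e i (suc b + i)            ≡⟨ cong (λ x → e i (x + i)) (Coordinates.N+2∸column a b i s) ⟨
      e i (n ∸ (i + suc a) + i)  ∎
      where open ≡-Reasoning

  matrixOf-multiSymmetricSteinhaus : IsMultiSymmetricSteinhaus (2 + N) (matrixOf N f)
  matrixOf-multiSymmetricSteinhaus =
    ( bounded⇒Fin (λ i → e i i ≡ false) (entry-matrixOf-diagonal f)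
    , bounded⇒Fin₂ (λ i j → 1 ≤ i → i < j → e i j ≡ e (i ∸ 1) (j ∸ 1) xor e (i ∸ 1) j) steinhaus-rule
    , bounded⇒Fin₂ (λ i j → e i j ≡ e j i) symmetric )
    , ( (λ i j → bounded⇒Fin₂ (λ i j → e i j ≡ e j i) symmetric i j
               , bounded⇒Fin₂ (λ i j → e j i ≡ e (suc N ∸ j) (suc N ∸ i)) antidiagonal-symmetric i j)
      , bounded⇒Fin₂ (λ i j → i < j → e i j ≡ e i (n ∸ j + i)) row-symmetric )


lowestFree : ℕ → ℕ
lowestFree N = (N + 2) / 3

highestFree : ℕ → ℕ
highestFree N = N / 2

freeCount : ℕ → ℕ
freeCount N = suc (highestFree N) ∸ lowestFree N

module _ (N : ℕ) where

  private
    lo = lowestFree N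
    hi = highestFree N

    triple : ∀ x → x + x + x ≡ x * 3
    triple = solve 1 (λ x → x :+ x :+ x := x :* con 3) refl

    double : ∀ x → x + x ≡ x * 2
    double = solve 1 (λ x → x :+ x := x :* con 2) refl

    N≤3·lowestFree : N ≤ lo + lo + lo
    N≤3·lowestFree = subst (N ≤_) (sym (triple lo)) (+-cancelˡ-≤ 2 N (lo * 3) (begin
      2 + N                 ≡⟨ +-comm 2 N ⟩
      N + 2                 ≡⟨ m≡m%n+[m/n]*n (N + 2) 3 ⟩
      (N + 2) % 3 + lo * 3  ≤⟨ +-monoˡ-≤ (lo * 3) (≤-pred (m%n<n (N + 2) 3)) ⟩
      2 + lo * 3            ∎))
      where open ≤-Reasoning

    lowestFree-least : ∀ b → N ≤ b + b + b → lo ≤ b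
    lowestFree-least b N≤3b = ≤-pred (m<n*o⇒m/o<n {N + 2} {suc b} {3} (begin-strict
      N + 2      <⟨ +-monoʳ-< N (n<1+n 2) ⟩
      N + 3      ≤⟨ +-monoˡ-≤ 3 (subst (N ≤_) (triple b) N≤3b) ⟩
      b * 3 + 3  ≡⟨ +-comm (b * 3) 3 ⟩
      suc b * 3  ∎))
      where open ≤-Reasoning

    highestFree-greatest : ∀ b → b + b ≤ N → b ≤ hi
    highestFree-greatest b 2b≤N = subst (_≤ hi) (m*n/n≡m b 2) (/-monoˡ-≤ 2 (subst (_≤ N) (double b) 2b≤N))

    ≤highestFree : ∀ x → x ≤ hi → x + x ≤ N
    ≤highestFree x x≤hi = subst (_≤ N) (sym (double x)) (≤-trans (*-monoˡ-≤ 2 x≤hi) (m/n*n≤m N 2))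

  lowestFree≤1+highestFree : lo ≤ suc hi
  lowestFree≤1+highestFree = ≤-trans (/-monoʳ-≤ (N + 2) {3} {2} (s≤s (s≤s z≤n)))
    (≤-reflexive (trans (+-distrib-/-∣ʳ N {2} {2} (divides 1 refl)) (+-comm hi 1)))

  free-offset : ∀ t → t < freeCount N → IsFree N (lo + t)
  free-offset t t<k =
    ≤-trans N≤3·lowestFree (+-mono-≤ (+-mono-≤ (m≤m+n lo t) (m≤m+n lo t)) (m≤m+n lo t)) ,
    ≤highestFree (lo + t)
      (≤-pred (subst (lo + t <_) (m+[n∸m]≡n lowestFree≤1+highestFree) (+-monoʳ-< lo t<k)))

  free-offset⁻¹ : ∀ b → IsFree N b → lo ≤ b × b ∸ lo < freeCount N
  free-offset⁻¹ b (N≤3b , 2b≤N) = lo≤b , +-cancelˡ-< lo (b ∸ lo) (freeCount N) (begin-strict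
    lo + (b ∸ lo)        ≡⟨ m+[n∸m]≡n lo≤b ⟩
    b                    <⟨ s≤s (highestFree-greatest b 2b≤N) ⟩
    suc hi               ≡⟨ m+[n∸m]≡n lowestFree≤1+highestFree ⟨
    lo + freeCount N     ∎)
    where
    open ≤-Reasoning
    lo≤b = lowestFree-least b N≤3b

freeCount-+6 : ∀ N → freeCount (6 + N) ≡ suc (freeCount N)
freeCount-+6 N = trans
  (cong₂ (λ x y → suc x ∸ y) (+-distrib-/-∣ˡ {6} N {2} (divides 3 refl))
                              (+-distrib-/-∣ˡ {6} (N + 2) {3} (divides 2 refl)))
  (+-∸-assoc 1 (lowestFree≤1+highestFree N))

freeCount-formula : ∀ N → (N % 2 ≡ 0 → freeCount N ≡ (2 + N + 5) / 6) ×
                          (N % 2 ≡ 1 → freeCount N ≡ (2 + N + 2) / 6)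
freeCount-formula 0 = (λ _ → refl) , λ ()
freeCount-formula 1 = (λ ()) , λ _ → refl
freeCount-formula 2 = (λ _ → refl) , λ ()
freeCount-formula 3 = (λ ()) , λ _ → refl
freeCount-formula 4 = (λ _ → refl) , λ ()
freeCount-formula 5 = (λ ()) , λ _ → refl
freeCount-formula (suc (suc (suc (suc (suc (suc N)))))) =
  step (2 + N + 5) (proj₁ (freeCount-formula N)) , step (2 + N + 2) (proj₂ (freeCount-formula N))
  where
  step : ∀ {parity : Set} m → (parity → freeCount N ≡ m / 6) → parity → freeCount (6 + N) ≡ (6 + m) / 6
  step m IH p =
    trans (freeCount-+6 N) (trans (cong suc (IH p)) (sym (+-distrib-/-∣ˡ {6} m {6} (divides 1 refl))))

bits : List Bool
bits = false ∷ true ∷ []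

bits-unique : Unique bits
bits-unique = ((λ ()) All.∷ All.[]) ∷ (All.[] ∷ [])

bits-complete : ∀ x → x ∈ bits
bits-complete false = here refl
bits-complete true  = there (here refl)

-- The free values at b = ⌈N/3⌉ + t, t < freeCount N, are the entries of a
-- vector; entry (v ∷ []) 0 reads v with default false out of range.
module _ (N : ℕ) where

  private
    lo = lowestFree N
    k  = freeCount N

    choice : Vec Bool k → ℕ → Bool
    choice v b = entry (v ∷ []) 0 (b ∸ lo)

    fromChoices : Vec Bool k → Matrix (2 + N)
    fromChoices v = matrixOf N (extend (choice v) N)

    choices : Matrix (2 + N) → Vec Bool k
    choices M = tabulateℕ k (λ t → freeValue N (atPoint M) (lo + t))

    choices-fromChoices : ∀ v → choices (fromChoices v) ≡ v
    choices-fromChoices v = trans (tabulateℕ-cong k free-values) (tabulateℕ-entry-head k v [])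
      where
      F = extend (choice v) N
      free-values : ∀ t → t < k → freeValue N (atPoint (matrixOf N F)) (lo + t) ≡ entry (v ∷ []) 0 t
      free-values t t<k = begin
        freeValue N (atPoint (matrixOf N F)) (lo + t)
          ≡⟨ freeValue-cong (entry-matrixOf-above F) (lo + t) (proj₂ free) ⟩
        freeValue N F (lo + t)                         ≡⟨ extend-free (choice v) N (lo + t) free ⟩
        entry (v ∷ []) 0 (lo + t ∸ lo)                 ≡⟨ cong (entry (v ∷ []) 0) (m+n∸m≡n lo t) ⟩
        entry (v ∷ []) 0 t                             ∎
        where
        open ≡-Reasoning
        free = free-offset N t t<k

    fromChoices-choices : ∀ M → IsMultiSymmetricSteinhaus (2 + N) M → fromChoices (choices M) ≡ M
    fromChoices-choices M mss = trans
      (matrixOf-cong N (triangle-unique (extend-symmetric π N) (atPoint-symmetric M mss) same-free-values))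
      (matrixOf-atPoint M mss)
      where
      π = choice (choices M)
      same-free-values : ∀ b → IsFree N b → freeValue N (extend π N) b ≡ freeValue N (atPoint M) b
      same-free-values b free = begin
        freeValue N (extend π N) b                  ≡⟨ extend-free π N b free ⟩
        entry (choices M ∷ []) 0 (b ∸ lo)           ≡⟨ entry-head-tabulateℕ k _ [] (b ∸ lo) offset<k ⟩
        freeValue N (atPoint M) (lo + (b ∸ lo))     ≡⟨ cong (freeValue N (atPoint M)) (m+[n∸m]≡n lo≤b) ⟩
        freeValue N (atPoint M) b                   ∎
        where
        open ≡-Reasoning
        lo≤b = proj₁ (free-offset⁻¹ N b free)
        offset<k = proj₂ (free-offset⁻¹ N b free)

  MS-count : MS (2 + N) ≡ 2 ^ freeCount N
  MS-count = trans
    (length-filter-bijection (isMSS? (2 + N)) (allMatrices (2 + N)) (allVecs bits k)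
      (allVecs-unique _ (allVecs-unique bits bits-unique (2 + N)) (2 + N))
      (allVecs-complete _ (allVecs-complete bits bits-complete (2 + N)) (2 + N))
      (allVecs-unique bits bits-unique k) (allVecs-complete bits bits-complete k)
      fromChoices choices (λ v → matrixOf-multiSymmetricSteinhaus (extend-symmetric (choice v) N))
      choices-fromChoices fromChoices-choices)
    (length-allVecs bits k)

theorem5 : (n : ℕ) → 1 ≤ n →
    (n % 2 ≡ 0 → MS n ≡ 2 ^ ((n + 5) / 6)) ×
    (n % 2 ≡ 1 → MS n ≡ 2 ^ ((n + 2) / 6))
theorem5 1 _ = (λ ()) , (λ _ → refl)
theorem5 (suc (suc N)) _ =
  (λ even → trans (MS-count N) (cong (2 ^_) (proj₁ (freeCount-formula N) even))) ,
  (λ odd  → trans (MS-count N) (cong (2 ^_) (proj₂ (freeCount-formula N) odd)))
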